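{- Let $L$ be a linear order, $\sigma\le\tau$ order types and $\chi$ a set. If $L\not\rightarrow(\sigma)^\sigma_\chi$ and there is a coherent selector $f:[L]^\tau\rightharpoonup[L]^\sigma$ whose domain is dense in $[L]^\tau$, then $L\not\rightarrow(\tau)^\tau_\chi$.
   Context: Work in ZF. $\sigma\le\tau$ means every linear order of type $\tau$ has a suborder of type $\sigma$. For a linear order $L$ and order type $\sigma$, $[L]^\sigma$ is the set of subsets of $L$ of induced order type $\sigma$. $\mathscr D\subseteq[L]^\tau$ is dense if every $A\in[L]^\tau$ has $[A]^\tau\cap\mathscr D\ne\emptyset$. A coherent selector is a partial function $f:[L]^\tau\rightharpoonup[L]^\sigma$ such that for every $A\in\mathrm{dom} f$: (a) $f(A)\subseteq A$; (b) for every $B\in[f(A)]^\sigma$, the set $A'=(A\setminus f(A))\cup B$ lies in $\mathrm{dom} f$ and $f(A')=B$. $L\rightarrow(\sigma)^\tau_\chi$ means: for every $F:[L]^\tau\to\chi$ there is $H\in[L]^\sigma$ with $|\{F(B):B\in[H]^\tau\}|=1$; $\not\rightarrow$ is its negation. -}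

module Defs where

open import Level using (0ℓ)
open import Data.Product using (Σ; ∃; _×_; _,_; proj₁)
open import Data.Sum using (_⊎_)
open import Data.Unit using (⊤)
open import Relation.Nullary using (¬_)
open import Relation.Unary using (Pred; _⊆_; _≐_)
open import Relation.Binary.PropositionalEquality using (_≡_)
open import Relation.Binary.Structures using (IsStrictTotalOrder)
open import Function.Bundles using (_⇔_)

record LinearOrder : Set₁ where
  field
    Carrier : Set
    _<_     : Carrier → Carrier → Set
    isStrictTotalOrder : IsStrictTotalOrder _≡_ _<_

open LinearOrder public

Subset : LinearOrder → Set₁
Subset L = Pred (Carrier L) 0ℓ

-- "A has induced order type σ": there is a strictly increasing map
-- from (a representative of) σ into L whose image is exactly A.
HasType : (L σ : LinearOrder) → Subset L → Set
HasType L σ A =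
  Σ (Carrier σ → Carrier L) λ g →
    (∀ s t → _<_ σ s t → _<_ L (g s) (g t)) ×
    (∀ x → A x ⇔ (∃ λ s → g s ≡ x))

IsOfType : (M τ : LinearOrder) → Set
IsOfType M τ = HasType M τ (λ _ → ⊤)

_≼_ : LinearOrder → LinearOrder → Set₁
σ ≼ τ = (M : LinearOrder) → IsOfType M τ → Σ (Subset M) (HasType M σ)

-- A ∈ [L]^τ is  HasType L τ A.
-- D ⊆ [L]^τ (given as a predicate on subsets) is dense.
Dense : (L τ : LinearOrder) → Pred (Subset L) 0ℓ → Set₁
Dense L τ D = (A : Subset L) → HasType L τ A →
  Σ (Subset L) λ B → B ⊆ A × HasType L τ B × D B

-- A partial function f : [L]^τ ⇀ [L]^σ on sets (subsets are predicates,
-- so we require invariance under extensional equality of subsets).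
record PartialSel (L σ τ : LinearOrder) : Set₁ where
  field
    dom    : Pred (Subset L) 0ℓ
    fun    : (A : Subset L) → dom A → Subset L
    dom-τ  : ∀ A → dom A → HasType L τ A
    cod-σ  : ∀ A (d : dom A) → HasType L σ (fun A d)
    dom-ext : ∀ A A' → A ≐ A' → dom A → dom A'
    fun-ext : ∀ A A' (d : dom A) (d' : dom A') → A ≐ A' → fun A d ≐ fun A' d'

Coherent : {L σ τ : LinearOrder} → PartialSel L σ τ → Set₁
Coherent {L} {σ} {τ} f =
  ∀ A (d : dom A) →
    (fun A d ⊆ A) ×
    (∀ (B : Subset L) → B ⊆ fun A d → HasType L σ B →
       let A' : Subset L
           A' = λ x → (A x × ¬ fun A d x) ⊎ B x
       in Σ (dom A') λ d' → fun A' d' ≐ B)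
  where open PartialSel f

-- A colouring F : [L]^τ → χ of τ-subsets (a function of the subset only).
Colouring : (L τ : LinearOrder) (χ : Set) → Set₁
Colouring L τ χ =
  Σ ((A : Subset L) → HasType L τ A → χ) λ F →
    ∀ A B (p : HasType L τ A) (q : HasType L τ B) → A ≐ B → F A p ≡ F B q

Arrow : (L σ τ : LinearOrder) (χ : Set) → Set₁
Arrow L σ τ χ = (F : Colouring L τ χ) →
  Σ (Subset L) λ H → HasType L σ H ×
    Σ (Subset L) λ B → B ⊆ H × Σ (HasType L τ B) λ p →
      ∀ (B' : Subset L) → B' ⊆ H → (p' : HasType L τ B') →
        proj₁ F B' p' ≡ proj₁ F B p

-- Pull a colouring F of [L]^σ back along the selector: colour A ∈ [L]^τ by
-- F (f A) when A ∈ dom f, and by a fixed default otherwise.  A homogeneous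
-- H ∈ [L]^τ for the pulled-back colouring contains some H₀ ∈ dom f by density,
-- and coherence realises every σ-subset B of f H₀ as f A' for the τ-set
-- A' = (H₀ ∖ f H₀) ∪ B ⊆ H; hence F B = G A' = G H₀ = F (f H₀), so f H₀ is
-- homogeneous for F.  Excluded middle decides membership in dom f (making the
-- pullback a function of the set alone) and supplies the default colour.
module Submission where

open import Defs
open import Level using (0ℓ)
open import Axiom.ExcludedMiddle using (ExcludedMiddle)
open import Data.Product using (Σ; _×_; _,_; proj₁; proj₂)
open import Data.Sum using (_⊎_; inj₁; inj₂)
open import Data.Empty using (⊥-elim)
open import Function using (id)
open import Relation.Nullary using (¬_; Dec; yes; no)
open import Relation.Unary using (_⊆_; _≐_)
open import Relation.Unary.Properties using (≐-refl; ≐-sym)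
open import Relation.Binary.PropositionalEquality using (_≡_; refl; sym; trans; module ≡-Reasoning)

Homogeneous : (L τ : LinearOrder) {χ : Set} → Colouring L τ χ → Subset L → Set₁
Homogeneous L τ F H = Σ (Subset L) λ B → B ⊆ H × Σ (HasType L τ B) λ p →
  ∀ B' → B' ⊆ H → (p' : HasType L τ B') → proj₁ F B' p' ≡ proj₁ F B p

homogeneous-colour-≡ : ∀ {L τ χ} (F : Colouring L τ χ) {H : Subset L} →
  Homogeneous L τ F H →
  ∀ {A B} → A ⊆ H → B ⊆ H → (p : HasType L τ A) (q : HasType L τ B) →
  proj₁ F A p ≡ proj₁ F B q
homogeneous-colour-≡ F (_ , _ , _ , hom) A⊆H B⊆H p q =
  trans (hom _ A⊆H p) (sym (hom _ B⊆H q))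

module Selector (em : ExcludedMiddle 0ℓ) {L σ τ : LinearOrder} {χ : Set}
  (f : PartialSel L σ τ) (coherent : Coherent f) where

  open PartialSel f

  colourSelection : Colouring L σ χ → (A : Subset L) → dom A → χ
  colourSelection F A d = proj₁ F (fun A d) (cod-σ A d)

  colourSelection-ext : (F : Colouring L σ χ) → ∀ {A A'} → A ≐ A' →
    (d : dom A) (d' : dom A') → colourSelection F A d ≡ colourSelection F A' d'
  colourSelection-ext F A≐A' d d' = proj₂ F _ _ _ _ (fun-ext _ _ d d' A≐A')

  pullbackOn : χ → Colouring L σ χ → (A : Subset L) → Dec (dom A) → χ
  pullbackOn c F A (yes d) = colourSelection F A d
  pullbackOn c F A (no _)  = c

  pullbackOn-ext : (c : χ) (F : Colouring L σ χ) → ∀ {A A'} → A ≐ A' →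
    (a : Dec (dom A)) (a' : Dec (dom A')) → pullbackOn c F A a ≡ pullbackOn c F A' a'
  pullbackOn-ext c F A≐A' (yes d) (yes d') = colourSelection-ext F A≐A' d d'
  pullbackOn-ext c F A≐A' (yes d) (no ¬d') = ⊥-elim (¬d' (dom-ext _ _ A≐A' d))
  pullbackOn-ext c F A≐A' (no ¬d) (yes d') = ⊥-elim (¬d (dom-ext _ _ (≐-sym A≐A') d'))
  pullbackOn-ext c F A≐A' (no _)  (no _)   = refl

  pullback : χ → Colouring L σ χ → Colouring L τ χ
  pullback c F = (λ A _ → pullbackOn c F A em) ,
                 (λ A A' _ _ A≐A' → pullbackOn-ext c F A≐A' em em)

  pullback-dom : (c : χ) (F : Colouring L σ χ) → ∀ {A} (p : HasType L τ A) (d : dom A) →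
    proj₁ (pullback c F) A p ≡ colourSelection F A d
  pullback-dom c F p d = pullbackOn-ext c F ≐-refl em (yes d)

  selection-homogeneous : (c : χ) (F : Colouring L σ χ) {H H₀ : Subset L} →
    Homogeneous L τ (pullback c F) H → H₀ ⊆ H → (d₀ : dom H₀) →
    Homogeneous L σ F (fun H₀ d₀)
  selection-homogeneous c F {H} {H₀} hom H₀⊆H d₀ =
    fun H₀ d₀ , id , cod-σ H₀ d₀ , same-colour
    where
    same-colour : ∀ B → B ⊆ fun H₀ d₀ → (p : HasType L σ B) →
      proj₁ F B p ≡ colourSelection F H₀ d₀
    same-colour B B⊆fH₀ p with proj₂ (coherent H₀ d₀) B B⊆fH₀ p
    ... | d' , fA'≐B = begin
      proj₁ F B p                        ≡⟨ proj₂ F _ _ _ _ (≐-sym fA'≐B) ⟩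
      colourSelection F A' d'            ≡⟨ sym (pullback-dom c F pA' d') ⟩
      proj₁ (pullback c F) A' pA'        ≡⟨ homogeneous-colour-≡ {L} {τ} (pullback c F) hom
                                              A'⊆H H₀⊆H pA' pH₀ ⟩
      proj₁ (pullback c F) H₀ pH₀        ≡⟨ pullback-dom c F pH₀ d₀ ⟩
      colourSelection F H₀ d₀            ∎
      where
      open ≡-Reasoning
      A' : Subset L
      A' x = (H₀ x × ¬ fun H₀ d₀ x) ⊎ B x
      pA' : HasType L τ A'
      pA' = dom-τ A' d'
      pH₀ : HasType L τ H₀
      pH₀ = dom-τ H₀ d₀
      A'⊆H : A' ⊆ H
      A'⊆H (inj₁ (h , _)) = H₀⊆H h
      A'⊆H (inj₂ b)       = H₀⊆H (proj₁ (coherent H₀ d₀) (B⊆fH₀ b))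

  module _ (dense : Dense L τ dom) (arrow : Arrow L τ τ χ) (F : Colouring L σ χ) where

    colourOfDenseSelection : (A : Subset L) → HasType L τ A → χ
    colourOfDenseSelection A p with dense A p
    ... | B , _ , _ , d = colourSelection F B d

    -- If χ were empty, any χ-valued function would be a colouring, so the
    -- arrow relation would still produce a τ-set to colour.
    defaultColour : χ
    defaultColour with em {χ}
    ... | yes c = c
    ... | no ¬c with arrow (colourOfDenseSelection , λ A _ p _ _ → ⊥-elim (¬c (colourOfDenseSelection A p)))
    ...   | H , pH , _ = colourOfDenseSelection H pH

    arrow-σ : Σ (Subset L) λ H → HasType L σ H × Homogeneous L σ F H
    arrow-σ with arrow (pullback defaultColour F)
    ... | H , pH , hom with dense H pH
    ... | H₀ , H₀⊆H , _ , d₀ =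
      fun H₀ d₀ , cod-σ H₀ d₀ , selection-homogeneous defaultColour F hom H₀⊆H d₀

mainTheorem9 : ExcludedMiddle 0ℓ →
    (L σ τ : LinearOrder) (χ : Set) →
    σ ≼ τ →
    ¬ Arrow L σ σ χ →
    (f : PartialSel L σ τ) → Coherent f → Dense L τ (PartialSel.dom f) →
    ¬ Arrow L τ τ χ
mainTheorem9 em L σ τ χ _ ¬arrow-σ f coherent dense arrow-τ =
  ¬arrow-σ (Selector.arrow-σ em f coherent dense arrow-τ)
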